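{- Let $x$ be a sequence of pairwise distinct integers of length $m$, let $i\in\{1,\ldots,m-1\}$ and $y=\tau(x,i)$. Suppose $x[i]>x[i+1]$. Then: (1) $\overrightarrow{PD}_y[i+1]=1$; (2) $\overleftarrow{PD}_y[i]=0$ if $\overleftarrow{PD}_x[i+1]=0$, and $\overleftarrow{PD}_y[i]=\overleftarrow{PD}_x[i+1]+1$ otherwise; (3) $\overrightarrow{PD}_y[i]=0$ if $\overrightarrow{PD}_x[i+1]=0$, and $\overrightarrow{PD}_y[i]=\overrightarrow{PD}_x[i+1]-1$ otherwise; (4) $\overleftarrow{PD}_y[i+1]\le m-i-1$ if $\overleftarrow{PD}_x[i+1]=0$, and $\overleftarrow{PD}_y[i+1]\le \overleftarrow{PD}_x[i+1]$ otherwise.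
   Context: All sequences consist of pairwise distinct integers. For $1\le i\le m-1$, $\tau(x,i)$ is the sequence obtained from $x$ by exchanging $x[i]$ and $x[i+1]$. $\overrightarrow{PD}_x[h]=h-\max\{j<h: x[j]<x[h]\}$ if such $j$ exists and $0$ otherwise; $\overleftarrow{PD}_x[h]=\min\{j>h: x[j]<x[h]\}-h$ if such $j$ exists and $0$ otherwise. -}

module Defs where

open import Data.Nat using (ℕ; zero; suc; _∸_; _≤_; _+_)
open import Data.Nat as ℕ using ()
open import Data.Integer using (ℤ; _<_; _<?_)
open import Data.Maybe using (Maybe; just; nothing; maybe)
open import Relation.Nullary using (yes; no)
open import Relation.Binary.PropositionalEquality using (_≡_)

-- A sequence of length m is a function ℕ → ℤ, of which only the
-- positions 1,…,m (1-based, as in the paper) are meaningful.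
Seq : Set
Seq = ℕ → ℤ

Distinct : ℕ → Seq → Set
Distinct m x = ∀ a b → 1 ≤ a → a ≤ m → 1 ≤ b → b ≤ m → x a ≡ x b → a ≡ b

τ : Seq → ℕ → Seq
τ x i k with k ℕ.≟ i
... | yes _ = x (suc i)
... | no _ with k ℕ.≟ suc i
...   | yes _ = x i
...   | no _ = x k

findPrev : Seq → ℤ → ℕ → Maybe ℕ
findPrev x v zero = nothing
findPrev x v (suc k) with x (suc k) <? v
... | yes _ = just (suc k)
... | no _ = findPrev x v k

findNext : Seq → ℤ → ℕ → ℕ → Maybe ℕ
findNext x v j zero = nothing
findNext x v j (suc n) with x j <? v
... | yes _ = just j
... | no _ = findNext x v (suc j) n

-- →PD_x[h] = h - max{ j < h : x[j] < x[h] }, or 0 if no such j (j ranges over 1..h-1)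
PDright : Seq → ℕ → ℕ
PDright x h = maybe (λ j → h ∸ j) 0 (findPrev x (x h) (h ∸ 1))

-- ←PD_x[h] = min{ j > h : x[j] < x[h] } - h, or 0 if no such j (j ranges over h+1..m)
PDleft : ℕ → Seq → ℕ → ℕ
PDleft m x h = maybe (λ j → j ∸ h) 0 (findNext x (x h) (suc h) (m ∸ h))

{-# OPTIONS --safe #-}
-- In y = τ(x,i) the
-- entry y[i] = x[i+1] is smaller than its right neighbour y[i+1] = x[i], so its
-- next smaller entry to the right is the one of x[i+1] in x, now one step further
-- away; to the left it finds the previous smaller entry of x[i+1] in x, now one
-- step closer, since x[i] was never a candidate. The entry y[i+1] = x[i] has
-- y[i] directly before it, and, being larger than x[i+1], it meets a smaller
-- entry to its right no later than x[i+1] did.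
module Submission where

open import Defs
open import Data.Nat as ℕ using (ℕ; zero; suc; _∸_; _≤_; _<_; _+_; z≤n; s≤s)
open import Data.Nat.Properties
  using (≤-refl; ≤-reflexive; ≤-trans; ≤-pred; m≤n⇒m≤1+n; m≤m+n; <⇒≤; <⇒≢; >⇒≢; m<n⇒m<1+n;
         1+n≢n; +-suc; +-comm; +-∸-assoc; ∸-+-assoc; ∸-monoˡ-≤; m+n∸n≡m; m+n∸m≡n; m>n⇒m∸n≢0)
open import Data.Integer as ℤ using (_>_; _<?_)
import Data.Integer.Properties as ℤ
open import Data.Maybe using (Maybe; just; nothing; maybe)
open import Data.Maybe.Relation.Unary.All as All using (All; just; nothing)
open import Data.Maybe.Relation.Unary.Any using (Any; just)
open import Data.Product using (_×_; _,_)
open import Data.Empty using (⊥-elim)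
open import Relation.Nullary using (yes; no; ¬_)
open import Relation.Binary.PropositionalEquality
  using (_≡_; _≢_; refl; sym; trans; cong; subst; module ≡-Reasoning)

open ≡-Reasoning

m≤n∸1⇒m<n : ∀ {m n} → 0 < m → m ≤ n ∸ 1 → m < n
m≤n∸1⇒m<n {n = zero}  (s≤s _) ()
m≤n∸1⇒m<n {n = suc _} _       m≤n = s≤s m≤n

m∸n∸1≡m∸[1+n] : ∀ m n → m ∸ n ∸ 1 ≡ m ∸ suc n
m∸n∸1≡m∸[1+n] m n = trans (∸-+-assoc m n 1) (cong (m ∸_) (+-comm n 1))

distanceFrom : ℕ → Maybe ℕ → ℕ
distanceFrom h = maybe (λ j → j ∸ h) 0

distanceTo : ℕ → Maybe ℕ → ℕ
distanceTo h = maybe (λ j → h ∸ j) 0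

distanceTo-suc : ∀ h t → distanceTo h t ≡ distanceTo (suc h) t ∸ 1
distanceTo-suc h nothing  = refl
distanceTo-suc h (just j) = sym (trans (∸-+-assoc (suc h) j 1) (cong (suc h ∸_) (+-comm j 1)))

distanceFrom-suc-≡0 : ∀ {h t} → All (suc h <_) t →
  distanceFrom (suc h) t ≡ 0 → distanceFrom h t ≡ 0
distanceFrom-suc-≡0 nothing      _   = refl
distanceFrom-suc-≡0 (just 1+h<j) d≡0 = ⊥-elim (m>n⇒m∸n≢0 1+h<j d≡0)

distanceFrom-suc-≢0 : ∀ {h t} → All (h <_) t →
  distanceFrom (suc h) t ≢ 0 → distanceFrom h t ≡ distanceFrom (suc h) t + 1
distanceFrom-suc-≢0 nothing d≢0 = ⊥-elim (d≢0 refl)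
distanceFrom-suc-≢0 {h} (just {j} h<j) _ = trans (+-∸-assoc 1 h<j) (+-comm 1 (j ∸ suc h))

distanceFrom-≤ : ∀ {h n t} → All (_≤ h + n) t → distanceFrom h t ≤ n
distanceFrom-≤ nothing = z≤n
distanceFrom-≤ {h} {n} (just j≤h+n) = ≤-trans (∸-monoˡ-≤ h j≤h+n) (≤-reflexive (m+n∸m≡n h n))

distanceFrom-≤-preceded : ∀ {h t u} → All (λ k → Any (_≤ k) u) t →
  distanceFrom h t ≢ 0 → distanceFrom h u ≤ distanceFrom h t
distanceFrom-≤-preceded nothing d≢0 = ⊥-elim (d≢0 refl)
distanceFrom-≤-preceded {h} (just (just j≤k)) _ = ∸-monoˡ-≤ h j≤k

findPrev-hit : ∀ {x v k} → x (suc k) ℤ.< v → findPrev x v (suc k) ≡ just (suc k)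
findPrev-hit {x} {v} {k} hit with x (suc k) <? v
... | yes _   = refl
... | no miss = ⊥-elim (miss hit)

findPrev-skip : ∀ {x v k} → ¬ (x (suc k) ℤ.< v) → findPrev x v (suc k) ≡ findPrev x v k
findPrev-skip {x} {v} {k} miss with x (suc k) <? v
... | yes hit = ⊥-elim (miss hit)
... | no _    = refl

findNext-skip : ∀ {x v s n} → ¬ (x s ℤ.< v) → findNext x v s (suc n) ≡ findNext x v (suc s) n
findNext-skip {x} {v} {s} miss with x s <? v
... | yes hit = ⊥-elim (miss hit)
... | no _    = refl

findPrev-cong : ∀ {x y v} n → (∀ k → k ≤ n → x k ≡ y k) → findPrev x v n ≡ findPrev y v n
findPrev-cong zero _ = refl
findPrev-cong {x} {y} {v} (suc n) x≗y with x (suc n) <? v | y (suc n) <? v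
... | yes _    | yes _    = refl
... | yes hitˣ | no missʸ = ⊥-elim (missʸ (subst (ℤ._< v) (x≗y (suc n) ≤-refl) hitˣ))
... | no missˣ | yes hitʸ = ⊥-elim (missˣ (subst (ℤ._< v) (sym (x≗y (suc n) ≤-refl)) hitʸ))
... | no _     | no _     = findPrev-cong n (λ k k≤n → x≗y k (m≤n⇒m≤1+n k≤n))

findNext-cong : ∀ {x y v} s n → (∀ k → s ≤ k → x k ≡ y k) → findNext x v s n ≡ findNext y v s n
findNext-cong s zero _ = refl
findNext-cong {x} {y} {v} s (suc n) x≗y with x s <? v | y s <? v
... | yes _    | yes _    = refl
... | yes hitˣ | no missʸ = ⊥-elim (missʸ (subst (ℤ._< v) (x≗y s ≤-refl) hitˣ))
... | no missˣ | yes hitʸ = ⊥-elim (missˣ (subst (ℤ._< v) (sym (x≗y s ≤-refl)) hitʸ))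
... | no _     | no _     = findNext-cong (suc s) n (λ k s<k → x≗y k (<⇒≤ s<k))

findNext-after : ∀ x v s n → All (s ≤_) (findNext x v s n)
findNext-after x v s zero = nothing
findNext-after x v s (suc n) with x s <? v
... | yes _ = just ≤-refl
... | no _  = All.map <⇒≤ (findNext-after x v (suc s) n)

findNext-within : ∀ x v s n → All (_< s + n) (findNext x v s n)
findNext-within x v s zero = nothing
findNext-within x v s (suc n) with x s <? v
... | yes _ = just (subst (s <_) (sym (+-suc s n)) (m≤m+n (suc s) n))
... | no _  = All.map (λ {j} → subst (j <_) (sym (+-suc s n))) (findNext-within x v (suc s) n)

-- Raising the threshold from v to w can only make the search stop earlier.
findNext-raise : ∀ x {v w} s n → v ℤ.≤ w →
  All (λ k → Any (_≤ k) (findNext x w s n)) (findNext x v s n)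
findNext-raise x s zero _ = nothing
findNext-raise x {v} {w} s (suc n) v≤w with x s <? w
... | yes _ = All.map just (findNext-after x v s (suc n))
... | no missʷ with x s <? v
...   | yes hitᵛ = ⊥-elim (missʷ (ℤ.<-≤-trans hitᵛ v≤w))
...   | no _     = findNext-raise x (suc s) n v≤w

PDleft-≤ : ∀ m x h → PDleft m x h ≤ m ∸ h
PDleft-≤ m x h = distanceFrom-≤ (All.map ≤-pred (findNext-within x (x h) (suc h) (m ∸ h)))

τ-at : ∀ x i → τ x i i ≡ x (suc i)
τ-at x i with i ℕ.≟ i
... | yes _    = refl
... | no i≢i = ⊥-elim (i≢i refl)

τ-at-suc : ∀ x i → τ x i (suc i) ≡ x i
τ-at-suc x i with suc i ℕ.≟ i
... | yes 1+i≡i = ⊥-elim (1+n≢n 1+i≡i)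
... | no _ with suc i ℕ.≟ suc i
...   | yes _     = refl
...   | no 1+i≢1+i = ⊥-elim (1+i≢1+i refl)

τ-outside : ∀ x i k → k ≢ i → k ≢ suc i → τ x i k ≡ x k
τ-outside x i k k≢i k≢1+i with k ℕ.≟ i
... | yes k≡i = ⊥-elim (k≢i k≡i)
... | no _ with k ℕ.≟ suc i
...   | yes k≡1+i = ⊥-elim (k≢1+i k≡1+i)
...   | no _      = refl

τ-below : ∀ x {i k} → k < i → τ x i k ≡ x k
τ-below x k<i = τ-outside x _ _ (<⇒≢ k<i) (<⇒≢ (m<n⇒m<1+n k<i))

τ-above : ∀ x {i k} → suc i < k → τ x i k ≡ x k
τ-above x 1+i<k = τ-outside x _ _ (>⇒≢ (<⇒≤ 1+i<k)) (>⇒≢ 1+i<k)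

findNext-τ-above : ∀ x i v n → findNext (τ x i) v (suc (suc i)) n ≡ findNext x v (suc (suc i)) n
findNext-τ-above x i v n = findNext-cong _ n (λ k 2+i≤k → τ-above x 2+i≤k)

PDright-τ-suc : ∀ x i → 0 < i → x (suc i) ℤ.< x i → PDright (τ x i) (suc i) ≡ 1
PDright-τ-suc x i@(suc h) _ descent = begin
  distanceTo (suc i) (findPrev y (y (suc i)) i)
    ≡⟨ cong (λ v → distanceTo (suc i) (findPrev y v i)) (τ-at-suc x i) ⟩
  distanceTo (suc i) (findPrev y (x i) i)
    ≡⟨ cong (distanceTo (suc i)) (findPrev-hit {y} {k = h} descentʸ) ⟩
  distanceTo (suc i) (just i)
    ≡⟨ m+n∸n≡m 1 i ⟩
  1 ∎
  where
  y : Seq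
  y = τ x i
  descentʸ : y i ℤ.< x i
  descentʸ = subst (ℤ._< x i) (sym (τ-at x i)) descent

PDright-τ-at : ∀ x i → ¬ (x i ℤ.< x (suc i)) → PDright (τ x i) i ≡ PDright x (suc i) ∸ 1
PDright-τ-at x zero _ = refl
PDright-τ-at x i@(suc h) ¬ascent = begin
  distanceTo i (findPrev y (y i) h)
    ≡⟨ cong (λ v → distanceTo i (findPrev y v h)) (τ-at x i) ⟩
  distanceTo i (findPrev y (x (suc i)) h)
    ≡⟨ cong (distanceTo i) (findPrev-cong {y} h (λ k k≤h → τ-below x (s≤s k≤h))) ⟩
  distanceTo i (findPrev x (x (suc i)) h)
    ≡⟨ distanceTo-suc i (findPrev x (x (suc i)) h) ⟩
  distanceTo (suc i) (findPrev x (x (suc i)) h) ∸ 1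
    ≡⟨ cong (λ t → distanceTo (suc i) t ∸ 1) (findPrev-skip {x} {k = h} ¬ascent) ⟨
  PDright x (suc i) ∸ 1 ∎
  where
  y : Seq
  y = τ x i

PDleft-τ-at : ∀ m x i → i < m → ¬ (x i ℤ.< x (suc i)) →
  PDleft m (τ x i) i ≡ distanceFrom i (findNext x (x (suc i)) (suc (suc i)) (m ∸ suc i))
PDleft-τ-at m x i i<m ¬ascent = begin
  distanceFrom i (findNext y (y i) (suc i) (m ∸ i))
    ≡⟨ cong (λ v → distanceFrom i (findNext y v (suc i) (m ∸ i))) (τ-at x i) ⟩
  distanceFrom i (findNext y (x (suc i)) (suc i) (m ∸ i))
    ≡⟨ cong (λ n → distanceFrom i (findNext y (x (suc i)) (suc i) n)) (+-∸-assoc 1 i<m) ⟩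
  distanceFrom i (findNext y (x (suc i)) (suc i) (suc (m ∸ suc i)))
    ≡⟨ cong (distanceFrom i) (findNext-skip {y} {s = suc i} ¬ascentʸ) ⟩
  distanceFrom i (findNext y (x (suc i)) (suc (suc i)) (m ∸ suc i))
    ≡⟨ cong (distanceFrom i) (findNext-τ-above x i (x (suc i)) (m ∸ suc i)) ⟩
  distanceFrom i (findNext x (x (suc i)) (suc (suc i)) (m ∸ suc i)) ∎
  where
  y : Seq
  y = τ x i
  ¬ascentʸ : ¬ (y (suc i) ℤ.< x (suc i))
  ¬ascentʸ = subst (λ v → ¬ (v ℤ.< x (suc i))) (sym (τ-at-suc x i)) ¬ascent

PDleft-τ-suc : ∀ m x i →
  PDleft m (τ x i) (suc i) ≡ distanceFrom (suc i) (findNext x (x i) (suc (suc i)) (m ∸ suc i))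
PDleft-τ-suc m x i = cong (distanceFrom (suc i)) (begin
  findNext (τ x i) (τ x i (suc i)) (suc (suc i)) (m ∸ suc i)
    ≡⟨ cong (λ v → findNext (τ x i) v (suc (suc i)) (m ∸ suc i)) (τ-at-suc x i) ⟩
  findNext (τ x i) (x i) (suc (suc i)) (m ∸ suc i)
    ≡⟨ findNext-τ-above x i (x i) (m ∸ suc i) ⟩
  findNext x (x i) (suc (suc i)) (m ∸ suc i) ∎)

lemma5 : (m : ℕ) (x : Seq) (i : ℕ) → Distinct m x → 1 ≤ i → i ≤ m ∸ 1 →
    x i > x (suc i) →
    (PDright (τ x i) (suc i) ≡ 1)
    × ((PDleft m x (suc i) ≡ 0 → PDleft m (τ x i) i ≡ 0)
       × (PDleft m x (suc i) ≢ 0 → PDleft m (τ x i) i ≡ PDleft m x (suc i) + 1))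
    × ((PDright x (suc i) ≡ 0 → PDright (τ x i) i ≡ 0)
       × (PDright x (suc i) ≢ 0 → PDright (τ x i) i ≡ PDright x (suc i) ∸ 1))
    × ((PDleft m x (suc i) ≡ 0 → PDleft m (τ x i) (suc i) ≤ m ∸ i ∸ 1)
       × (PDleft m x (suc i) ≢ 0 → PDleft m (τ x i) (suc i) ≤ PDleft m x (suc i)))
lemma5 m x i _ 0<i i≤m∸1 descent =
    PDright-τ-suc x i 0<i descent
  , ( (λ pd≡0 → trans PDleftʸᵢ (distanceFrom-suc-≡0 beyond pd≡0))
    , (λ pd≢0 → trans PDleftʸᵢ (distanceFrom-suc-≢0 (All.map <⇒≤ beyond) pd≢0)) )
  , ( (λ pd≡0 → trans PDrightʸᵢ (cong (_∸ 1) pd≡0))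
    , (λ _ → PDrightʸᵢ) )
  , ( (λ _ → subst (PDleft m y (suc i) ≤_) (sym (m∸n∸1≡m∸[1+n] m i)) (PDleft-≤ m y (suc i)))
    , (λ pd≢0 → subst (_≤ PDleft m x (suc i)) (sym (PDleft-τ-suc m x i))
                  (distanceFrom-≤-preceded {suc i} earlier pd≢0)) )
  where
  y : Seq
  y = τ x i
  n : ℕ
  n = m ∸ suc i
  ¬ascent : ¬ (x i ℤ.< x (suc i))
  ¬ascent = ℤ.<-asym descent
  PDleftʸᵢ : PDleft m y i ≡ distanceFrom i (findNext x (x (suc i)) (suc (suc i)) n)
  PDleftʸᵢ = PDleft-τ-at m x i (m≤n∸1⇒m<n 0<i i≤m∸1) ¬ascent
  PDrightʸᵢ : PDright y i ≡ PDright x (suc i) ∸ 1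
  PDrightʸᵢ = PDright-τ-at x i ¬ascent
  beyond : All (suc i <_) (findNext x (x (suc i)) (suc (suc i)) n)
  beyond = findNext-after x (x (suc i)) (suc (suc i)) n
  earlier : All (λ k → Any (_≤ k) (findNext x (x i) (suc (suc i)) n))
                (findNext x (x (suc i)) (suc (suc i)) n)
  earlier = findNext-raise x (suc (suc i)) n (ℤ.<⇒≤ descent)
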